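{- Let $h,p,r$ be positive integers with $r\geq 3$. Let $H$ be an $r$-uniform leveled linear quasi-tree of height $h$ rooted at $w$ with segments $H_0,\ldots,H_{h-1}$, main levels $L_0,\ldots,L_h$ and companion levels $L'_0,\ldots,L'_{h-1}$. Let $S\subseteq L_h$ with $|S|\geq (hpr)^h$. Then there exists a vertex $x\in L_i\cup L'_i$ for some $0\leq i\leq h-1$ such that (1) $|V(H_x)\cap S|\geq \frac{|S|}{(hpr)^{h-1}}$, and (2) $H_x$ contains a spider centered at $x$ with $p$ legs, each of which is a monotone path from $x$ to a vertex of $V(H_x)\cap S$.
   Context: An $r$-graph is an $r$-uniform hypergraph; linear means any two distinct edges share at most one vertex. For a bipartite graph $B$, an $r$-graph $F$ is the $r$-expansion of $B$ if its edges are exactly the sets $f\cup A_f$ ($f\in B$), with the $A_f$ being $(r-2)$-sets of vertices outside $V(B)$, pairwise disjoint. A linear $r$-graph $H$ is a leveled linear quasi-tree of height $h$ rooted at $w$ if it is the union of $r$-graphs $H_0,\ldots,H_{h-1}$ such that: (1) each $H_i$ is $r$-partite without isolated vertices with parts $L_i,L'_i,J^{(1)}_i,\ldots,J^{(r-2)}_i$, and $H_i$ is the $r$-expansion of $B_i=\{e\cap(L_i\cup L'_i):e\in H_i\}$; (2) $J^{(r-2)}_i=L_{i+1}$; (3) $V(H_i)\cap V(H_{i+1})=L_{i+1}$ and $V(H_i)\cap V(H_j)=\emptyset$ for $|i-j|>1$; (4) $L_0=\{w\}$. The $L_i$ are main levels, the $L'_i$ companion levels. For $f\in B_i$, the representative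 of $f$ is the unique vertex of $L_{i+1}$ in the edge of $H_i$ containing $f$; for $x\in V(B_i)$, the children of $x$ are the representatives of edges of $B_i$ incident to $x$. For $x\in L_i\cup L'_i$ ($i\leq h-1$), the down tree $T_x$ is the graph obtained by joining $x$ to its children, then each of these to its children in the next main level, and so on until the levels run out; the down graph $H_x$ is the subgraph of $H$ consisting of, for each edge of $T_x$, the unique edge of $H$ containing it. A (linear) path is a sequence of edges $e_1,\ldots,e_k$ with consecutive edges sharing exactly one vertex and non-consecutive edges disjoint; a path is monotone if it meets each main level in at most one vertex. A spider centered at $x$ with $p$ legs consists of $p$ linear paths (legs) sharing the endpoint $x$ and otherwise vertex-disjoint. -}

module Defs where

open import Data.Nat using (ℕ; zero; suc; _+_; _*_; _∸_; _^_; _≤_; _<_)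
open import Data.Fin using (Fin; toℕ; inject₁; fromℕ) renaming (zero to fzero; suc to fsuc)
open import Data.List using (List; []; _∷_; _++_; map; length; lookup; concatMap; allFin)
open import Data.List.Membership.Propositional using (_∈_)
open import Data.List.Relation.Unary.All using (All)
open import Data.List.Relation.Unary.Any using (Any)
open import Data.List.Relation.Unary.Unique.Propositional using (Unique)
open import Data.Product using (Σ; _×_; ∃-syntax; Σ-syntax)
open import Data.Sum using (_⊎_)
open import Data.Empty using (⊥)
open import Relation.Binary.PropositionalEquality using (_≡_; _≢_)

-- Vertices are natural numbers; an edge is a list of (distinct) vertices.
Edge : Set
Edge = List ℕ

-- Raw data of a leveled linear quasi-tree of uniformity r and height h rooted at w.
--   seg i      = H_i                      (i < h)
--   L j        = main level L_j           (j ≤ h)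
--   L' i       = companion level L'_i     (i < h)
--   J i k      = J^{(k+1)}_i              (k < r-3), i.e. J^{(1)}_i .. J^{(r-3)}_i;
--                the last part J^{(r-2)}_i is by definition L_{i+1}   (condition (2)).
record LQT (r h w : ℕ) : Set where
  field
    seg : Fin h → List Edge
    L   : Fin (suc h) → List ℕ
    L'  : Fin h → List ℕ
    J   : Fin h → Fin (r ∸ 3) → List ℕ

VP : List Edge → ℕ → Set
VP es u = Any (u ∈_) es

IsPath : List Edge → Set
IsPath es =
  (∀ (a b : Fin (length es)) → suc (toℕ a) ≡ toℕ b →
     ∃[ u ] (u ∈ lookup es a × u ∈ lookup es b ×
             (∀ v → v ∈ lookup es a → v ∈ lookup es b → v ≡ u)))
  × (∀ (a b : Fin (length es)) → suc (toℕ a) < toℕ b →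
       ∀ v → v ∈ lookup es a → v ∈ lookup es b → ⊥)

PathFromTo : List Edge → ℕ → ℕ → Set
PathFromTo es x v =
  IsPath es × x ≢ v
  × VP es x × (∀ (b : Fin (length es)) → x ∈ lookup es b → toℕ b ≡ 0)
  × VP es v × (∀ (b : Fin (length es)) → v ∈ lookup es b → suc (toℕ b) ≡ length es)

module _ {r h w : ℕ} (Q : LQT r h w) where
  open LQT Q

  Lo : Fin h → List ℕ
  Lo i = L (inject₁ i)

  Lnext : Fin h → List ℕ
  Lnext i = L (fsuc i)

  parts : Fin h → List (List ℕ)
  parts i = Lo i ∷ L' i ∷ (map (J i) (allFin (r ∸ 3)) ++ (Lnext i ∷ []))

  edges : List Edge
  edges = concatMap seg (allFin h)

  VH : Fin h → ℕ → Set
  VH i v = ∃[ e ] (e ∈ seg i × v ∈ e)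

  record IsLQT : Set where
    field
      uniform    : All (λ e → Unique e × length e ≡ r) edges
      linear     : ∀ (a b : Fin (length edges)) → a ≢ b → ∀ u v →
                     u ∈ lookup edges a → v ∈ lookup edges a →
                     u ∈ lookup edges b → v ∈ lookup edges b → u ≡ v
      -- (1) H_i is r-partite with parts L_i, L'_i, J^{(1)}_i, ..., J^{(r-2)}_i
      partsDisjoint : ∀ i (a b : Fin (length (parts i))) → a ≢ b → ∀ v →
                     v ∈ lookup (parts i) a → v ∈ lookup (parts i) b → ⊥
      oneInEach  : ∀ i e → e ∈ seg i → ∀ P → P ∈ parts i →
                     ∃[ v ] (v ∈ e × v ∈ P × (∀ u → u ∈ e → u ∈ P → u ≡ v))
      covered    : ∀ i e → e ∈ seg i → ∀ v → v ∈ e → ∃[ P ] (P ∈ parts i × v ∈ P)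
      noIsolated : ∀ i P → P ∈ parts i → ∀ v → v ∈ P → VH i v
      -- (1) H_i is the r-expansion of B_i : the sets e \ (L_i ∪ L'_i) are pairwise disjoint
      expansion  : ∀ i (a b : Fin (length (seg i))) → a ≢ b → ∀ v →
                     v ∈ lookup (seg i) a → v ∈ lookup (seg i) b → v ∈ Lo i ⊎ v ∈ L' i
      levelShared : ∀ (i j : Fin h) → toℕ j ≡ suc (toℕ i) → ∀ v → v ∈ Lnext i → VH i v × VH j v
      overlapV   : ∀ (i j : Fin h) (v : ℕ) → VH i v → VH j v →
                     i ≡ j ⊎ (toℕ j ≡ suc (toℕ i) × v ∈ Lnext i)
                           ⊎ (toℕ i ≡ suc (toℕ j) × v ∈ Lnext j)
      root       : L fzero ≡ w ∷ []

  Child : ℕ → ℕ → Set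
  Child y c = ∃[ i ] ∃[ e ] (e ∈ seg i × y ∈ e × (y ∈ Lo i ⊎ y ∈ L' i) × c ∈ e × c ∈ Lnext i)

  data Reach (x : ℕ) : ℕ → Set where
    here : Reach x x
    step : ∀ {y c} → Reach x y → Child y c → Reach x c

  TEdge : ℕ → ℕ → ℕ → Set
  TEdge x y c = Reach x y × Child y c

  InHx : ℕ → Edge → Set
  InHx x e = e ∈ edges × ∃[ y ] ∃[ c ] (TEdge x y c × y ∈ e × c ∈ e)

  VHx : ℕ → ℕ → Set
  VHx x v = ∃[ e ] (InHx x e × v ∈ e)

  Monotone : List Edge → Set
  Monotone es = ∀ (j : Fin (suc h)) (u v : ℕ) → VP es u → VP es v → u ∈ L j → v ∈ L j → u ≡ v

  Spider : ℕ → ℕ → List ℕ → Set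
  Spider x p S =
    Σ[ legs ∈ (Fin p → List Edge) ]
      ((∀ a → All (InHx x) (legs a) × Monotone (legs a)
              × ∃[ s ] (s ∈ S × VHx x s × PathFromTo (legs a) x s))
       × (∀ a b → a ≢ b → ∀ u → VP (legs a) u → VP (legs b) u → u ≡ x))

-- Weigh a vertex y by the number of targets below it, |S ∩ V(T_y)|, and put K = hpr. The root has
-- weight |S|, so some level i carries a vertex of weight at least |S| / K^i; let x be one on the
-- deepest such level. Then x has weight at least |S| / K^(h-1) ≥ K, while every vertex strictly below
-- level i weighs less than (weight x) / K. The legs are descending paths from x to targets, chosen
-- greedily: a leg forbids its at most hr vertices below the edge at x (plus that edge's
-- representative), all of weight < (weight x) / K, so fewer than p legs have fewer than weight x
-- targets below their forbidden vertices and some target below x is still free. Its path meets the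
-- earlier legs only at x, since by linearity and the expansion property any other shared vertex
-- would be a forbidden ancestor of the new target.

module Submission where

open import Defs
open import Data.Nat
  using (ℕ; zero; suc; _+_; _*_; _∸_; _^_; _≤_; _<_; z≤n; s≤s; s<s⁻¹; NonZero; >-nonZero; >-nonZero⁻¹)
open import Data.Nat.Properties
open import Data.Fin using (Fin; toℕ; fromℕ; fromℕ<; inject₁) renaming (zero to fzero; suc to fsuc)
open import Data.Fin.Properties using (toℕ-injective; toℕ-inject₁; toℕ-fromℕ; toℕ-fromℕ<; toℕ<n)
open import Data.List using (List; []; _∷_; _++_; length; lookup; map; concat; concatMap; allFin; filter)
import Data.List.Properties as List
open import Data.List.Membership.Propositional using (_∈_; _∉_; find; lose)
open import Data.List.Membership.Propositional.Properties
open import Data.List.Membership.DecPropositional _≟_ using (_∈?_)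
open import Data.List.Relation.Unary.All as All using (All; []; _∷_; all?)
open import Data.List.Relation.Unary.All.Properties using (¬All⇒Any¬) renaming (++⁺ to All-++⁺)
open import Data.List.Relation.Unary.Any as Any using (here; there; any?)
open import Data.List.Relation.Unary.Any.Properties using (lookup-index)
open import Data.List.Relation.Unary.Unique.Propositional using (Unique)
open import Data.List.Relation.Unary.Unique.Propositional.Properties using (filter⁺)
open import Data.List.Relation.Unary.AllPairs using (_∷_)
open import Data.Product using (_×_; _,_; proj₁; proj₂; ∃-syntax; Σ-syntax)
open import Data.Sum using (_⊎_; inj₁; inj₂)
open import Data.Empty using (⊥; ⊥-elim)
open import Relation.Nullary using (¬_; Dec; yes; no; _×-dec_; _⊎-dec_)
open import Relation.Binary.PropositionalEquality hiding (J)

Unique-⊆⇒length-≤ : ∀ {A : Set} {xs ys : List A} → Unique xs → (∀ {a} → a ∈ xs → a ∈ ys) →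
                    length xs ≤ length ys
Unique-⊆⇒length-≤ {xs = []} _ _ = z≤n
Unique-⊆⇒length-≤ {xs = a ∷ xs} (a∉xs ∷ uxs) xs⊆ys with ∈-∃++ (xs⊆ys (here refl))
... | us , vs , refl = begin
  suc (length xs)              ≤⟨ s≤s (Unique-⊆⇒length-≤ uxs xs⊆us++vs) ⟩
  suc (length (us ++ vs))      ≡⟨ cong suc (List.length-++ us) ⟩
  suc (length us + length vs)  ≡⟨ +-suc (length us) (length vs) ⟨
  length us + length (a ∷ vs)  ≡⟨ List.length-++ us ⟨
  length (us ++ a ∷ vs)        ∎
  where
  open ≤-Reasoning
  xs⊆us++vs : ∀ {b} → b ∈ xs → b ∈ us ++ vs
  xs⊆us++vs {b} b∈xs with ∈-++⁻ us (xs⊆ys (there b∈xs))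
  ... | inj₁ b∈us         = ∈-++⁺ˡ b∈us
  ... | inj₂ (here refl)  = ⊥-elim (All.lookup a∉xs b∈xs refl)
  ... | inj₂ (there b∈vs) = ∈-++⁺ʳ us b∈vs

∃∉-of-shorter : ∀ {xs ys : List ℕ} → Unique xs → length ys < length xs → ∃[ a ] (a ∈ xs × a ∉ ys)
∃∉-of-shorter {xs} {ys} uxs ys<xs with all? (_∈? ys) xs
... | yes xs⊆ys = ⊥-elim (<⇒≱ ys<xs (Unique-⊆⇒length-≤ uxs (All.lookup xs⊆ys)))
... | no xs⊈ys  = find (¬All⇒Any¬ (_∈? ys) xs xs⊈ys)

length-concatMap-*-≤ : ∀ {A B : Set} (f : A → List B) {K c : ℕ} (xs : List A) →
                       All (λ a → length (f a) * K ≤ c) xs → length (concatMap f xs) * K ≤ length xs * c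
length-concatMap-*-≤ f [] [] = z≤n
length-concatMap-*-≤ f {K} {c} (a ∷ xs) (fa≤c ∷ fxs≤c) = begin
  length (f a ++ concatMap f xs) * K                  ≡⟨ cong (_* K) (List.length-++ (f a)) ⟩
  (length (f a) + length (concatMap f xs)) * K        ≡⟨ *-distribʳ-+ K (length (f a)) _ ⟩
  length (f a) * K + length (concatMap f xs) * K      ≤⟨ +-mono-≤ fa≤c (length-concatMap-*-≤ f xs fxs≤c) ⟩
  c + length xs * c                                   ∎
  where open ≤-Reasoning

length-concat-uniform : ∀ {A : Set} {r : ℕ} (xss : List (List A)) → All (λ xs → length xs ≡ r) xss →
                        length (concat xss) ≡ length xss * r
length-concat-uniform []         []          = refl
length-concat-uniform (xs ∷ xss) (refl ∷ rs) =
  trans (List.length-++ xs) (cong (length xs +_) (length-concat-uniform xss rs))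

index-≢ : ∀ {A : Set} {xs : List A} {a b : A} (a∈ : a ∈ xs) (b∈ : b ∈ xs) →
          a ≢ b → Any.index a∈ ≢ Any.index b∈
index-≢ {xs = xs} a∈ b∈ a≢b eq =
  a≢b (trans (lookup-index a∈) (trans (cong (lookup xs) eq) (sym (lookup-index b∈))))

Meets : Edge → Edge → Set
Meets e e' = ∃[ u ] (u ∈ e × u ∈ e' × (∀ v → v ∈ e → v ∈ e' → v ≡ u))

Disjoint : Edge → Edge → Set
Disjoint e e' = ∀ v → v ∈ e → v ∈ e' → ⊥

MeetOnlyAt : ℕ → List Edge → List Edge → Set
MeetOnlyAt x es es' = ∀ u → VP es u → VP es' u → u ≡ x

IsPath-[_] : ∀ e → IsPath (e ∷ [])
IsPath-[ e ] = (λ { fzero fzero () }) , (λ { fzero fzero () })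

IsPath-∷ : ∀ {e e' es} → IsPath (e' ∷ es) → Meets e e' → (∀ b → Disjoint e (lookup es b)) →
           IsPath (e ∷ e' ∷ es)
IsPath-∷ {e} {e'} {es} (meets , apart) e∩e' e∩es = meets′ , apart′
  where
  es′ : List Edge
  es′ = e ∷ e' ∷ es
  meets′ : ∀ a b → suc (toℕ a) ≡ toℕ b → Meets (lookup es′ a) (lookup es′ b)
  meets′ fzero    (fsuc fzero)     _  = e∩e'
  meets′ (fsuc a) (fsuc b)         eq = meets a b (suc-injective eq)
  meets′ fzero    fzero            ()
  meets′ fzero    (fsuc (fsuc b))  ()
  meets′ (fsuc a) fzero            ()
  apart′ : ∀ a b → suc (toℕ a) < toℕ b → Disjoint (lookup es′ a) (lookup es′ b)
  apart′ fzero    (fsuc (fsuc b)) _  = e∩es b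
  apart′ (fsuc a) (fsuc b)        lt = apart a b (s<s⁻¹ lt)
  apart′ fzero    fzero           ()
  apart′ fzero    (fsuc fzero)    (s≤s ())
  apart′ (fsuc a) fzero           ()

module QuasiTree {r h w : ℕ} (Q : LQT r h w) (isQ : IsLQT Q) where
  open LQT Q
  open IsLQT isQ

  InB : Fin h → ℕ → Set
  InB j y = y ∈ Lo Q j ⊎ y ∈ L' j

  InB? : ∀ j y → Dec (InB j y)
  InB? j y = (y ∈? Lo Q j) ⊎-dec (y ∈? L' j)

  Lo∈parts : ∀ {j} → Lo Q j ∈ parts Q j
  Lo∈parts = here refl

  L'∈parts : ∀ {j} → L' j ∈ parts Q j
  L'∈parts = there (here refl)

  Lnext∈parts : ∀ {j} → Lnext Q j ∈ parts Q j
  Lnext∈parts {j} = there (there (∈-++⁺ʳ (map (J j) (allFin (r ∸ 3))) (here refl)))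

  InB⇒∉Lnext : ∀ {j v} → InB j v → v ∉ Lnext Q j
  InB⇒∉Lnext {j} {v} v∈B v∈N = disjoint v∈B
    where
    v∈N′ : v ∈ lookup (parts Q j) (Any.index (Lnext∈parts {j}))
    v∈N′ = subst (v ∈_) (lookup-index (Lnext∈parts {j})) v∈N
    disjoint : InB j v → ⊥
    disjoint (inj₁ v∈Lo) = partsDisjoint j fzero        (Any.index Lnext∈parts) (λ ()) v v∈Lo v∈N′
    disjoint (inj₂ v∈L') = partsDisjoint j (fsuc fzero) (Any.index Lnext∈parts) (λ ()) v v∈L' v∈N′

  edge∩part : ∀ {j e P} → e ∈ seg j → P ∈ parts Q j → ∃[ v ] (v ∈ e × v ∈ P)
  edge∩part {j} {e} {P} e∈ P∈ with oneInEach j e e∈ P P∈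
  ... | v , v∈e , v∈P , _ = v , v∈e , v∈P

  edge∩part-unique : ∀ {j e P u v} → e ∈ seg j → P ∈ parts Q j →
                     u ∈ e → u ∈ P → v ∈ e → v ∈ P → u ≡ v
  edge∩part-unique {j} {e} {P} {u} {v} e∈ P∈ u∈e u∈P v∈e v∈P with oneInEach j e e∈ P P∈
  ... | _ , _ , _ , only = trans (only u u∈e u∈P) (sym (only v v∈e v∈P))

  InB⇒VH : ∀ {j v} → InB j v → VH Q j v
  InB⇒VH {j} {v} (inj₁ v∈Lo) = noIsolated j _ Lo∈parts v v∈Lo
  InB⇒VH {j} {v} (inj₂ v∈L') = noIsolated j _ L'∈parts v v∈L'

  Lnext⇒VH : ∀ {j v} → v ∈ Lnext Q j → VH Q j v
  Lnext⇒VH {j} {v} = noIsolated j _ Lnext∈parts v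

  seg⊆edges : ∀ {j e} → e ∈ seg j → e ∈ edges Q
  seg⊆edges {j} e∈ = ∈-concatMap⁺ seg {xs = allFin h} (lose (∈-allFin j) e∈)

  expansion-≢ : ∀ {j e e' v} → e ∈ seg j → e' ∈ seg j → e ≢ e' → v ∈ e → v ∈ e' → InB j v
  expansion-≢ {j} {v = v} e∈ e'∈ e≢e' v∈e v∈e' =
    expansion j (Any.index e∈) (Any.index e'∈) (index-≢ e∈ e'∈ e≢e') v
      (subst (v ∈_) (lookup-index e∈) v∈e) (subst (v ∈_) (lookup-index e'∈) v∈e')

  linear-≢ : ∀ {e e' u v} → e ∈ edges Q → e' ∈ edges Q → e ≢ e' →
             u ∈ e → v ∈ e → u ∈ e' → v ∈ e' → u ≡ v
  linear-≢ {u = u} {v} e∈ e'∈ e≢e' u∈e v∈e u∈e' v∈e' =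
    linear (Any.index e∈) (Any.index e'∈) (index-≢ e∈ e'∈ e≢e') u v
      (subst (u ∈_) (lookup-index e∈) u∈e) (subst (v ∈_) (lookup-index e∈) v∈e)
      (subst (u ∈_) (lookup-index e'∈) u∈e') (subst (v ∈_) (lookup-index e'∈) v∈e')

  L-cong : ∀ {a b : Fin (suc h)} → toℕ a ≡ toℕ b → L a ≡ L b
  L-cong eq = cong L (toℕ-injective eq)

  L≡Lo : ∀ {K : Fin (suc h)} {j : Fin h} → toℕ K ≡ toℕ j → L K ≡ Lo Q j
  L≡Lo {K} {j} eq = L-cong (trans eq (sym (toℕ-inject₁ j)))

  L≡Lnext : ∀ {K : Fin (suc h)} {j : Fin h} → toℕ K ≡ suc (toℕ j) → L K ≡ Lnext Q j
  L≡Lnext {K} {j} = L-cong {K} {fsuc j}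

  InB-segment-unique : ∀ {i j y} → InB i y → InB j y → i ≡ j
  InB-segment-unique {i} {j} {y} y∈Bi y∈Bj with overlapV i j y (InB⇒VH y∈Bi) (InB⇒VH y∈Bj)
  ... | inj₁ i≡j               = i≡j
  ... | inj₂ (inj₁ (_ , y∈N)) = ⊥-elim (InB⇒∉Lnext y∈Bi y∈N)
  ... | inj₂ (inj₂ (_ , y∈N)) = ⊥-elim (InB⇒∉Lnext y∈Bj y∈N)

  Lnext∩InB⇒successor : ∀ {j j' c} → c ∈ Lnext Q j → InB j' c → toℕ j' ≡ suc (toℕ j)
  Lnext∩InB⇒successor {j} {j'} {c} c∈N c∈B with overlapV j j' c (Lnext⇒VH c∈N) (InB⇒VH c∈B)
  ... | inj₁ refl              = ⊥-elim (InB⇒∉Lnext c∈B c∈N)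
  ... | inj₂ (inj₁ (t , _))    = t
  ... | inj₂ (inj₂ (_ , c∈N')) = ⊥-elim (InB⇒∉Lnext c∈B c∈N')

  VH⇒≤InB-segment : ∀ {j j' y} → InB j' y → VH Q j y → toℕ j ≤ toℕ j'
  VH⇒≤InB-segment {j} {j'} {y} y∈B y∈Hj with overlapV j' j y (InB⇒VH y∈B) y∈Hj
  ... | inj₁ refl             = ≤-refl
  ... | inj₂ (inj₁ (_ , y∈N)) = ⊥-elim (InB⇒∉Lnext y∈B y∈N)
  ... | inj₂ (inj₂ (t , _))   = subst (toℕ j ≤_) (sym t) (n≤1+n _)

  Lnext∩VH⇒same-or-successor : ∀ {k j c} → c ∈ Lnext Q k → VH Q j c →
                               toℕ j ≡ toℕ k ⊎ toℕ j ≡ suc (toℕ k)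
  Lnext∩VH⇒same-or-successor {k} {j} {c} c∈N c∈Hj with overlapV k j c (Lnext⇒VH c∈N) c∈Hj
  ... | inj₁ refl              = inj₁ refl
  ... | inj₂ (inj₁ (t , _))    = inj₂ t
  ... | inj₂ (inj₂ (t , c∈N')) = ⊥-elim (InB⇒∉Lnext (inj₁ (subst (c ∈_) (L≡Lo (sym t)) c∈N')) c∈N)

  L∩VH⇒level : ∀ {K j u} → u ∈ L K → VH Q j u → toℕ K ≡ toℕ j ⊎ toℕ K ≡ suc (toℕ j)
  L∩VH⇒level {fzero} {fzero}  u∈L u∈Hj = inj₁ refl
  L∩VH⇒level {fzero} {fsuc j} u∈L u∈Hj with VH⇒≤InB-segment {j' = fzero} (inj₁ u∈L) u∈Hj
  ... | ()
  L∩VH⇒level {fsuc K} u∈L u∈Hj with Lnext∩VH⇒same-or-successor {K} u∈L u∈Hj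
  ... | inj₁ t = inj₂ (cong suc (sym t))
  ... | inj₂ t = inj₁ (sym t)

  Lh∩VH⇒last : ∀ {j v} → v ∈ L (fromℕ h) → VH Q j v → suc (toℕ j) ≡ h
  Lh∩VH⇒last {j} v∈Lh v∈Hj with L∩VH⇒level {fromℕ h} v∈Lh v∈Hj
  ... | inj₁ t = ⊥-elim (<-irrefl (trans (sym t) (toℕ-fromℕ h)) (toℕ<n j))
  ... | inj₂ t = trans (sym t) (toℕ-fromℕ h)

  InB⇒∉Lh : ∀ {j x} → InB j x → x ∉ L (fromℕ h)
  InB⇒∉Lh {j} x∈B x∈Lh =
    InB⇒∉Lnext x∈B (subst (_ ∈_) (L≡Lnext (trans (toℕ-fromℕ h) (sym (Lh∩VH⇒last x∈Lh (InB⇒VH x∈B)))))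
                           x∈Lh)

  VH-adjacent : ∀ {j j' v} → VH Q j v → VH Q j' v → toℕ j' ≤ suc (toℕ j)
  VH-adjacent {j} {j'} {v} v∈Hj v∈Hj' with overlapV j j' v v∈Hj v∈Hj'
  ... | inj₁ refl           = n≤1+n _
  ... | inj₂ (inj₁ (t , _)) = ≤-reflexive t
  ... | inj₂ (inj₂ (t , _)) = ≤-trans (n≤1+n _) (≤-trans (≤-reflexive (sym t)) (n≤1+n _))

  successive-edges-meet : ∀ {j j' e e' c v} → e ∈ seg j → e' ∈ seg j' → toℕ j' ≡ suc (toℕ j) →
                          c ∈ e → c ∈ Lnext Q j → v ∈ e → v ∈ e' → v ≡ c
  successive-edges-meet {j} {j'} {v = v} e∈ e'∈ t c∈e c∈N v∈e v∈e'
    with overlapV j j' v (_ , e∈ , v∈e) (_ , e'∈ , v∈e')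
  ... | inj₁ refl             = ⊥-elim (<-irrefl t (n<1+n _))
  ... | inj₂ (inj₁ (_ , v∈N)) = edge∩part-unique e∈ Lnext∈parts v∈e v∈N c∈e c∈N
  ... | inj₂ (inj₂ (t' , _))  = ⊥-elim (<-irrefl (trans t (cong suc t')) (m≤n⇒m≤1+n (n<1+n _)))

  module _ (i : Fin h) (x : ℕ) (Forbidden : ℕ → Set) where

    ForbiddingEdge : Fin h → Edge → Set
    ForbiddingEdge j e = e ∈ seg j ×
      ((j ≡ i × x ∈ e × (∀ v → v ∈ e → v ∈ Lnext Q j → Forbidden v))
       ⊎ (toℕ i < toℕ j × (∀ v → v ∈ e → Forbidden v)))

    AvoidingEdge : Fin h → Edge → Set
    AvoidingEdge j e = e ∈ seg j ×
      (∀ v → v ∈ e → InB j v ⊎ v ∈ Lnext Q j → ¬ Forbidden v) ×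
      ((j ≡ i × x ∈ e) ⊎ toℕ i < toℕ j)

    private
      Lnext-forbidden : ∀ {j e v} → ForbiddingEdge j e → v ∈ e → v ∈ Lnext Q j → Forbidden v
      Lnext-forbidden (_ , inj₁ (_ , _ , f)) v∈e v∈N = f _ v∈e v∈N
      Lnext-forbidden (_ , inj₂ (_ , f))     v∈e _   = f _ v∈e

      same-segment : ∀ {j eA eB u} → u ≢ x → ForbiddingEdge j eA → AvoidingEdge j eB →
                     u ∈ eA → u ∈ eB → ⊥
      same-segment {j} {eA} {eB} {u} u≢x A@(eA∈ , roleA) (eB∈ , avoid , roleB) u∈eA u∈eB
        with List.≡-dec _≟_ eA eB
      ... | yes refl with edge∩part eA∈ Lnext∈parts
      ...   | v , v∈e , v∈N = avoid v v∈e (inj₂ v∈N) (Lnext-forbidden A v∈e v∈N)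
      same-segment {j} {eA} {eB} {u} u≢x A@(eA∈ , roleA) (eB∈ , avoid , roleB) u∈eA u∈eB
          | no eA≢eB with roleA | roleB
      ... | inj₂ (_ , f)            | _                 =
        avoid u u∈eB (inj₁ (expansion-≢ eA∈ eB∈ eA≢eB u∈eA u∈eB)) (f u u∈eA)
      ... | inj₁ (refl , _ , _)     | inj₂ i<i          = <-irrefl refl i<i
      ... | inj₁ (refl , x∈eA , _)  | inj₁ (_ , x∈eB)   =
        u≢x (sym (linear-≢ (seg⊆edges eA∈) (seg⊆edges eB∈) eA≢eB x∈eA u∈eA x∈eB u∈eB))

    -- A shared vertex u ≠ x is forbidden by eA and lies in a non-J part of eB, unless eA and eB are
    -- distinct edges through both x and u, which linearity excludes.
    forbidding∩avoiding⊆root : ∀ {jA jB eA eB u} → ForbiddingEdge jA eA → AvoidingEdge jB eB →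
                               u ∈ eA → u ∈ eB → u ≡ x
    forbidding∩avoiding⊆root {jA} {jB} {u = u} A@(eA∈ , roleA) B@(eB∈ , avoid , roleB) u∈eA u∈eB
      with u ≟ x
    ... | yes u≡x = u≡x
    ... | no u≢x with overlapV jA jB u (_ , eA∈ , u∈eA) (_ , eB∈ , u∈eB)
    ...   | inj₁ refl = ⊥-elim (same-segment u≢x A B u∈eA u∈eB)
    ...   | inj₂ (inj₁ (t , u∈N)) =
      ⊥-elim (avoid u u∈eB (inj₁ (inj₁ (subst (u ∈_) (L≡Lo {fsuc jA} (sym t)) u∈N)))
                    (Lnext-forbidden A u∈eA u∈N))
    ...   | inj₂ (inj₂ (t , u∈N)) with roleA | roleB
    ...     | inj₂ (_ , f)        | _               = ⊥-elim (avoid u u∈eB (inj₂ u∈N) (f u u∈eA))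
    ...     | inj₁ (refl , _)     | inj₁ (refl , _) = ⊥-elim (<-irrefl t (n<1+n _))
    ...     | inj₁ (refl , _)     | inj₂ i<jB       =
      ⊥-elim (<⇒≱ i<jB (≤-trans (n≤1+n _) (≤-reflexive (sym t))))

module Descendants {r h w : ℕ} (Q : LQT r h w) (isQ : IsLQT Q) where
  open LQT Q
  open IsLQT isQ
  open QuasiTree Q isQ

  ChildVia : Fin h → Edge → ℕ → ℕ → Set
  ChildVia j e y c = y ∈ e × InB j y × c ∈ Lnext Q j

  childVia? : ∀ j e y c → Dec (ChildVia j e y c)
  childVia? j e y c = (y ∈? e) ×-dec InB? j y ×-dec (c ∈? Lnext Q j)

  children : ℕ → List ℕ
  children y = concatMap (λ j → concatMap (λ e → filter (childVia? j e y) e) (seg j)) (allFin h)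

  children-sound : ∀ {y c} → c ∈ children y → Child Q y c
  children-sound {y} {c} c∈ with find (∈-concatMap⁻ _ {xs = allFin h} c∈)
  ... | j , _ , c∈j with find (∈-concatMap⁻ _ {xs = seg j} c∈j)
  ... | e , e∈ , c∈e′ with ∈-filter⁻ (childVia? j e y) {xs = e} c∈e′
  ... | c∈e , y∈e , y∈B , c∈N = j , e , e∈ , y∈e , y∈B , c∈e , c∈N

  children-complete : ∀ {y c} → Child Q y c → c ∈ children y
  children-complete {y} (j , e , e∈ , y∈e , y∈B , c∈e , c∈N) =
    ∈-concatMap⁺ _ {xs = allFin h} (lose (∈-allFin j)
      (∈-concatMap⁺ _ {xs = seg j} (lose e∈ (∈-filter⁺ (childVia? j e y) c∈e (y∈e , y∈B , c∈N)))))

  desc : ℕ → ℕ → List ℕ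
  desc zero    y = y ∷ []
  desc (suc n) y = y ∷ concatMap (desc n) (children y)

  desc-self : ∀ n {y} → y ∈ desc n y
  desc-self zero    = here refl
  desc-self (suc n) = here refl

  desc-step : ∀ {n y c s} → c ∈ children y → s ∈ desc n c → s ∈ desc (suc n) y
  desc-step {n} {y} c∈ s∈ = there (∈-concatMap⁺ (desc n) {xs = children y} (lose c∈ s∈))

  desc-suc⁻ : ∀ {n y s} → s ∈ desc (suc n) y → s ≡ y ⊎ ∃[ c ] (c ∈ children y × s ∈ desc n c)
  desc-suc⁻           (here s≡y) = inj₁ s≡y
  desc-suc⁻ {n} {y} (there s∈)  = inj₂ (find (∈-concatMap⁻ (desc n) {xs = children y} s∈))

  desc-mono : ∀ {n n' y s} → n ≤ n' → s ∈ desc n y → s ∈ desc n' y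
  desc-mono {zero}  {n'}     _         (here refl) = desc-self n'
  desc-mono {suc n} {suc n'} (s≤s n≤n') s∈ with desc-suc⁻ s∈
  ... | inj₁ refl              = here refl
  ... | inj₂ (c , c∈ , s∈c) = desc-step c∈ (desc-mono n≤n' s∈c)

  desc-child : ∀ {n z y v} → y ∈ desc n z → v ∈ children y → v ∈ desc (suc n) z
  desc-child {zero} (here refl) v∈ = desc-step {n = 0} v∈ (desc-self 0)
  desc-child {suc n} y∈ v∈ with desc-suc⁻ y∈
  ... | inj₁ refl           = desc-step {n = suc n} v∈ (desc-self (suc n))
  ... | inj₂ (c , c∈ , y∈c) = desc-step {n = suc n} c∈ (desc-child y∈c v∈)

  childless-desc : ∀ {n y s} → (∀ j → ¬ InB j y) → s ∈ desc n y → s ≡ y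
  childless-desc {zero}  _       (here refl) = refl
  childless-desc {suc n} no-kids s∈ with desc-suc⁻ s∈
  ... | inj₁ s≡y = s≡y
  ... | inj₂ (c , c∈ , _) = ⊥-elim (parent-InB (children-sound c∈))
    where
    parent-InB : ∀ {c} → Child Q _ c → ⊥
    parent-InB (j , _ , _ , _ , y∈B , _) = no-kids j y∈B

  L⊆desc-root : ∀ k (K : Fin (suc h)) → toℕ K ≡ k → ∀ {v} → v ∈ L K → v ∈ desc k w
  L⊆desc-root zero    fzero    _  v∈L = subst (_ ∈_) root v∈L
  L⊆desc-root (suc k) (fsuc K) eq v∈L with Lnext⇒VH {K} v∈L
  ... | e , e∈ , v∈e with edge∩part e∈ (Lo∈parts {K})
  ... | y , y∈e , y∈Lo =
    desc-child (L⊆desc-root k (inject₁ K) (trans (toℕ-inject₁ K) (suc-injective eq)) y∈Lo)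
               (children-complete (K , e , e∈ , y∈e , inj₁ y∈Lo , v∈e , v∈L))

  Lh⊆desc-root : ∀ {v} → v ∈ L (fromℕ h) → v ∈ desc h w
  Lh⊆desc-root = L⊆desc-root h (fromℕ h) (toℕ-fromℕ h)

module Chains {r h w : ℕ} (Q : LQT r h w) (isQ : IsLQT Q) where
  open LQT Q
  open IsLQT isQ
  open QuasiTree Q isQ
  open Descendants Q isQ

  Covers : ℕ → Fin h → Edge → Set
  Covers s j e = ∀ u → u ∈ e → InB j u ⊎ u ∈ Lnext Q j → s ∈ desc h u

  -- A descending path from y ∈ V(B_k) to s through one edge of each of H_k, H_{k+1}, …,
  -- every vertex of these edges outside the J-parts being an ancestor of s.
  data Chain (s : ℕ) : ℕ → ℕ → Set where
    end  : ∀ {k} → Chain s k s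
    step : ∀ {k y c} (j : Fin h) (e : Edge) → toℕ j ≡ k → e ∈ seg j → y ∈ e → InB j y →
           c ∈ e → c ∈ Lnext Q j → Covers s j e → Chain s (suc k) c → Chain s k y

  chain-to : ∀ {s} n {k y} → n ≤ h → s ∈ desc n y → (∀ j → InB j y → toℕ j ≡ k) → Chain s k y
  chain-to zero _ (here refl) _ = end
  chain-to {s} (suc n) {k} {y} n<h s∈ level with desc-suc⁻ s∈
  ... | inj₁ refl           = end
  ... | inj₂ (c , c∈ , s∈c) = descend (children-sound c∈) s∈c
    where
    n≤h : n ≤ h
    n≤h = ≤-trans (n≤1+n n) n<h
    descend : ∀ {c} → Child Q y c → s ∈ desc n c → Chain s k y
    descend {c} (j , e , e∈ , y∈e , y∈B , c∈e , c∈N) s∈c =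
      step j e (level j y∈B) e∈ y∈e y∈B c∈e c∈N covers (chain-to n n≤h s∈c level-c)
      where
      level-c : ∀ j' → InB j' c → toℕ j' ≡ suc k
      level-c j' c∈B = trans (Lnext∩InB⇒successor c∈N c∈B) (cong suc (level j y∈B))
      covers : Covers s j e
      covers u u∈e (inj₁ u∈B) =
        desc-mono n<h (desc-step (children-complete (j , e , e∈ , u∈e , u∈B , c∈e , c∈N)) s∈c)
      covers u u∈e (inj₂ u∈N) =
        subst (λ z → s ∈ desc h z) (edge∩part-unique e∈ Lnext∈parts c∈e c∈N u∈e u∈N)
              (desc-mono n≤h s∈c)

  module _ {s : ℕ} where

    edgesOf : ∀ {k y} → Chain s k y → List Edge
    edgesOf end                           = []
    edgesOf (step _ e _ _ _ _ _ _ _ rest) = e ∷ edgesOf rest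

    edges-below : ∀ {k y e} (ch : Chain s k y) → e ∈ edgesOf ch →
                  ∃[ j ] (e ∈ seg j × k ≤ toℕ j × Covers s j e)
    edges-below (step j e refl e∈ _ _ _ _ cov rest) (here refl) = j , e∈ , ≤-refl , cov
    edges-below (step j e refl e∈ _ _ _ _ cov rest) (there e'∈) with edges-below rest e'∈
    ... | j' , e'∈seg , k<j' , cov' = j' , e'∈seg , ≤-trans (n≤1+n _) k<j' , cov'

    length-edgesOf : ∀ {k y} (ch : Chain s k y) → length (edgesOf ch) ≤ h ∸ k
    length-edgesOf end = z≤n
    length-edgesOf (step j _ refl _ _ _ _ _ _ rest) =
      ≤-trans (s≤s (length-edgesOf rest)) (≤-reflexive (sym (+-∸-assoc 1 (toℕ<n j))))

    chain-isPath : ∀ {k y} (ch : Chain s k y) → IsPath (edgesOf ch)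
    chain-isPath end = (λ ()) , (λ ())
    chain-isPath (step _ e _ _ _ _ _ _ _ end) = IsPath-[ e ]
    chain-isPath (step j e refl e∈ _ _ c∈e c∈N _ rest@(step _ _ t e'∈ c∈e' _ _ _ _ rest')) =
      IsPath-∷ (chain-isPath rest)
               (_ , c∈e , c∈e' , λ v v∈e v∈e' → successive-edges-meet e∈ e'∈ t c∈e c∈N v∈e v∈e') far
      where
      far : ∀ b → Disjoint e (lookup (edgesOf rest') b)
      far b v v∈e v∈eb with edges-below rest' (∈-lookup b)
      ... | _ , eb∈ , k+2≤ , _ = <⇒≱ k+2≤ (VH-adjacent (e , e∈ , v∈e) (_ , eb∈ , v∈eb))

    start∈path : ∀ {k y v} (ch : Chain s k y) → VP (edgesOf ch) v → VP (edgesOf ch) y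
    start∈path (step _ _ _ _ y∈e _ _ _ _ _) _ = here y∈e

    path-level-≥ : ∀ {k y v K} (ch : Chain s k y) → VP (edgesOf ch) v → v ∈ L K → k ≤ toℕ K
    path-level-≥ ch v∈path v∈L with find v∈path
    ... | e , e∈ch , v∈e with edges-below ch e∈ch
    ... | j , e∈ , k≤j , _ with L∩VH⇒level v∈L (e , e∈ , v∈e)
    ...   | inj₁ t = ≤-trans k≤j (≤-reflexive (sym t))
    ...   | inj₂ t = ≤-trans k≤j (≤-trans (n≤1+n _) (≤-reflexive (sym t)))

    chain-monotone : ∀ {k y} (ch : Chain s k y) → Monotone Q (edgesOf ch)
    chain-monotone (step {c = c} j e refl e∈ _ _ c∈e c∈N _ rest) K = λ where
        u v (here u∈e)  (here v∈e)  u∈L v∈L → within-edge u∈e v∈e u∈L v∈L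
        u v (here u∈e)  (there v∈r) u∈L v∈L → head∩rest u∈e v∈r u∈L v∈L
        u v (there u∈r) (here v∈e)  u∈L v∈L → sym (head∩rest v∈e u∈r v∈L u∈L)
        u v (there u∈r) (there v∈r) u∈L v∈L → chain-monotone rest K u v u∈r v∈r u∈L v∈L
      where
      within-edge : ∀ {u v} → u ∈ e → v ∈ e → u ∈ L K → v ∈ L K → u ≡ v
      within-edge u∈e v∈e u∈L v∈L with L∩VH⇒level u∈L (e , e∈ , u∈e)
      ... | inj₁ t = edge∩part-unique e∈ Lo∈parts u∈e (subst (_ ∈_) (L≡Lo t) u∈L)
                                                  v∈e (subst (_ ∈_) (L≡Lo t) v∈L)
      ... | inj₂ t = edge∩part-unique e∈ Lnext∈parts u∈e (subst (_ ∈_) (L≡Lnext t) u∈L)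
                                                     v∈e (subst (_ ∈_) (L≡Lnext t) v∈L)
      head∩rest : ∀ {u v} → u ∈ e → VP (edgesOf rest) v → u ∈ L K → v ∈ L K → u ≡ v
      head∩rest {u} {v} u∈e v∈r u∈L v∈L with L∩VH⇒level u∈L (e , e∈ , u∈e)
      ... | inj₁ t = ⊥-elim (<-irrefl (sym t) (path-level-≥ rest v∈r v∈L))
      ... | inj₂ t = trans (edge∩part-unique e∈ Lnext∈parts u∈e (subst (_ ∈_) (L≡Lnext t) u∈L) c∈e c∈N)
                           (chain-monotone rest K c v (start∈path rest v∈r) v∈r
                                           (subst (c ∈_) (sym (L≡Lnext t)) c∈N) v∈L)

    target∈path : ∀ {k y} (ch : Chain s k y) → y ≢ s → VP (edgesOf ch) s
    target∈path end y≢s = ⊥-elim (y≢s refl)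
    target∈path (step {c = c} _ _ _ _ _ _ c∈e _ _ rest) _ with c ≟ s
    ... | yes refl = here c∈e
    ... | no c≢s   = there (target∈path rest c≢s)

    start-only-in-head : ∀ {k y} (ch : Chain s k y) b → y ∈ lookup (edgesOf ch) b → toℕ b ≡ 0
    start-only-in-head (step _ _ _ _ _ _ _ _ _ _) fzero _ = refl
    start-only-in-head (step j _ refl _ _ y∈B _ _ _ rest) (fsuc b) y∈eb with edges-below rest (∈-lookup b)
    ... | _ , eb∈ , k<j' , _ = ⊥-elim (<⇒≱ k<j' (VH⇒≤InB-segment y∈B (_ , eb∈ , y∈eb)))

    target-only-in-last : ∀ {k y} → s ∈ L (fromℕ h) → (ch : Chain s k y) →
                          ∀ b → s ∈ lookup (edgesOf ch) b → suc (toℕ b) ≡ length (edgesOf ch)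
    target-only-in-last s∈Lh (step _ _ _ _ _ _ _ _ _ end) fzero _ = refl
    target-only-in-last s∈Lh (step j e refl e∈ _ _ _ _ _ (step j' _ t _ _ _ _ _ _ _)) fzero s∈e =
      ⊥-elim (<-irrefl (trans t (Lh∩VH⇒last s∈Lh (e , e∈ , s∈e))) (toℕ<n j'))
    target-only-in-last s∈Lh (step _ _ _ _ _ _ _ _ _ rest) (fsuc b) s∈eb =
      cong suc (target-only-in-last s∈Lh rest b s∈eb)

    chain-in-Hx : ∀ {x k y} → Reach Q x y → (ch : Chain s k y) → All (InHx Q x) (edgesOf ch)
    chain-in-Hx x↝y end = []
    chain-in-Hx {y = y} x↝y (step {c = c} j e _ e∈ y∈e y∈B c∈e c∈N _ rest) =
      (seg⊆edges e∈ , y , c , (x↝y , y→c) , y∈e , c∈e) ∷ chain-in-Hx (step x↝y y→c) rest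
      where
      y→c : Child Q y c
      y→c = j , e , e∈ , y∈e , y∈B , c∈e , c∈N

    chain-PathFromTo : ∀ {j k x} → InB j x → s ∈ L (fromℕ h) → (ch : Chain s k x) → PathFromTo (edgesOf ch) x s
    chain-PathFromTo x∈B s∈Lh ch =
      chain-isPath ch , x≢s , start∈path ch s∈path , start-only-in-head ch , s∈path , target-only-in-last s∈Lh ch
      where
      x≢s : _ ≢ s
      x≢s refl = InB⇒∉Lh x∈B s∈Lh
      s∈path : VP (edgesOf ch) s
      s∈path = target∈path ch x≢s

    chain-VHx : ∀ {j k x} → InB j x → s ∈ L (fromℕ h) → (ch : Chain s k x) → VHx Q x s
    chain-VHx x∈B s∈Lh ch with find (target∈path ch λ { refl → InB⇒∉Lh x∈B s∈Lh })
    ... | e , e∈ch , s∈e = e , All.lookup (chain-in-Hx here ch) e∈ch , s∈e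

    edges-uniform : ∀ {k y} (ch : Chain s k y) → All (λ e → length e ≡ r) (edgesOf ch)
    edges-uniform ch = All.tabulate λ e∈ch →
      proj₂ (All.lookup uniform (seg⊆edges (proj₁ (proj₂ (edges-below ch e∈ch)))))

    -- The first edge's B_k-vertex other than y may be heavy, so of that edge only the
    -- representative is forbidden.
    forbidden : ∀ {k y} → Chain s k y → List ℕ
    forbidden end                                   = []
    forbidden (step {c = c} _ _ _ _ _ _ _ _ _ rest) = c ∷ concat (edgesOf rest)

    length-forbidden : ∀ {k y} → 1 ≤ r → (ch : Chain s k y) → length (forbidden ch) ≤ length (edgesOf ch) * r
    length-forbidden _ end = z≤n
    length-forbidden 1≤r (step _ _ _ _ _ _ _ _ _ rest) = begin
      suc (length (concat (edgesOf rest)))  ≡⟨ cong suc (length-concat-uniform (edgesOf rest) (edges-uniform rest)) ⟩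
      suc (length (edgesOf rest) * r)       ≤⟨ +-monoˡ-≤ _ 1≤r ⟩
      r + length (edgesOf rest) * r         ∎
      where open ≤-Reasoning

    module _ (i : Fin h) (x : ℕ) where

      chain-edge-position : ∀ {e} (ch : Chain s (toℕ i) x) → e ∈ edgesOf ch →
                            ∃[ j ] (e ∈ seg j × Covers s j e × ((j ≡ i × x ∈ e) ⊎ toℕ i < toℕ j))
      chain-edge-position (step j e eq e∈ x∈e _ _ _ cov _) (here refl) =
        j , e∈ , cov , inj₁ (toℕ-injective eq , x∈e)
      chain-edge-position (step _ _ _ _ _ _ _ _ _ rest) (there e∈rest) with edges-below rest e∈rest
      ... | j , e∈ , i<j , cov = j , e∈ , cov , inj₂ i<j

      chain-forbidding : ∀ {e} (ch : Chain s (toℕ i) x) → e ∈ edgesOf ch →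
                         ∃[ j ] ForbiddingEdge i x (_∈ forbidden ch) j e
      chain-forbidding (step j e eq e∈ x∈e _ c∈e c∈N _ _) (here refl) =
        j , e∈ , inj₁ (toℕ-injective eq , x∈e ,
                       λ v v∈e v∈N → here (edge∩part-unique e∈ Lnext∈parts v∈e v∈N c∈e c∈N))
      chain-forbidding (step _ _ _ _ _ _ _ _ _ rest) (there e∈rest) with edges-below rest e∈rest
      ... | j , e∈ , i<j , _ = j , e∈ , inj₂ (i<j , λ v v∈e → there (∈-concat⁺′ v∈e e∈rest))

      chain-avoiding : ∀ {e} {Forbidden : ℕ → Set} (ch : Chain s (toℕ i) x) →
                       (∀ u → Forbidden u → s ∉ desc h u) →
                       e ∈ edgesOf ch → ∃[ j ] AvoidingEdge i x Forbidden j e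
      chain-avoiding ch blocked e∈ch with chain-edge-position ch e∈ch
      ... | j , e∈ , cov , position =
        j , e∈ , (λ v v∈e role forbidden-v → blocked v forbidden-v (cov v v∈e role)) , position

  legs-meet-at-root : ∀ {i x sA sB} (A : Chain sA (toℕ i) x) (B : Chain sB (toℕ i) x) →
                      (∀ u → u ∈ forbidden A → sB ∉ desc h u) →
                      MeetOnlyAt x (edgesOf A) (edgesOf B)
  legs-meet-at-root {i} {x} A B blocked u u∈A u∈B with find u∈A | find u∈B
  ... | eA , eA∈ , u∈eA | eB , eB∈ , u∈eB =
    forbidding∩avoiding⊆root i x _ (proj₂ (chain-forbidding i x A eA∈))
                                   (proj₂ (chain-avoiding i x B blocked eB∈)) u∈eA u∈eB

module Spiders (h p r w : ℕ) (1≤h : 1 ≤ h) (1≤p : 1 ≤ p) (3≤r : 3 ≤ r)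
               (Q : LQT r h w) (isQ : IsLQT Q) (S : List ℕ) (unique-S : Unique S)
               (S⊆Lh : All (λ s → s ∈ LQT.L Q (fromℕ h)) S) (S-large : (h * p * r) ^ h ≤ length S) where
  open LQT Q
  open QuasiTree Q isQ
  open Descendants Q isQ
  open Chains Q isQ

  K : ℕ
  K = h * p * r

  1≤r : 1 ≤ r
  1≤r = ≤-trans (s≤s z≤n) 3≤r

  1≤h*r : 1 ≤ h * r
  1≤h*r = *-mono-≤ 1≤h 1≤r

  instance
    K≢0 : NonZero K
    K≢0 = >-nonZero (*-mono-≤ (*-mono-≤ 1≤h 1≤p) 1≤r)

  K^≢0 : ∀ n → NonZero (K ^ n)
  K^≢0 n = m^n≢0 K n

  below : ℕ → List ℕ
  below y = filter (_∈? desc h y) S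

  weight : ℕ → ℕ
  weight y = length (below y)

  weight-root : weight w ≡ length S
  weight-root = cong length (List.filter-all (_∈? desc h w) (All.map Lh⊆desc-root S⊆Lh))

  Heavy : Fin h → ℕ → Set
  Heavy i x = length S ≤ weight x * K ^ toℕ i

  NoHeavyBelow : ℕ → Set
  NoHeavyBelow m = ∀ j → m < toℕ j → ∀ y → InB j y → weight y * K ^ toℕ j < length S

  DeepestHeavy : Set
  DeepestHeavy = ∃[ i ] ∃[ x ] (InB i x × Heavy i x × NoHeavyBelow (toℕ i))

  private
    InB⇒∈Lo++L' : ∀ {j y} → InB j y → y ∈ Lo Q j ++ L' j
    InB⇒∈Lo++L' (inj₁ y∈Lo) = ∈-++⁺ˡ y∈Lo
    InB⇒∈Lo++L' (inj₂ y∈L') = ∈-++⁺ʳ _ y∈L'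

  search : ∀ m (m<h : m < h) → NoHeavyBelow m → DeepestHeavy
  search m m<h none-below
    with any? (λ y → length S ≤? weight y * K ^ m) (Lo Q (fromℕ< m<h) ++ L' (fromℕ< m<h))
  ... | yes heavy-here with find heavy-here
  ...   | y , y∈ , heavy =
    fromℕ< m<h , y , ∈-++⁻ (Lo Q _) y∈ ,
    subst (λ n → length S ≤ weight y * K ^ n) (sym (toℕ-fromℕ< m<h)) heavy ,
    subst NoHeavyBelow (sym (toℕ-fromℕ< m<h)) none-below
  search zero m<h _ | no none-here =
    ⊥-elim (none-here (lose (∈-++⁺ˡ w∈L₀) (≤-reflexive (sym (trans (*-identityʳ _) weight-root)))))
    where
    w∈L₀ : w ∈ Lo Q (fromℕ< m<h)
    w∈L₀ = subst (w ∈_) (L≡Lo {fzero} (sym (toℕ-fromℕ< m<h))) (subst (w ∈_) (sym (IsLQT.root isQ)) (here refl))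
  search (suc m) m<h none-below | no none-here = search m (<-trans (n<1+n m) m<h) none-below′
    where
    none-below′ : NoHeavyBelow m
    none-below′ j m<j y y∈B with m≤n⇒m<n∨m≡n m<j
    ... | inj₁ 1+m<j = none-below j 1+m<j y y∈B
    ... | inj₂ 1+m≡j with toℕ-injective {i = fromℕ< m<h} {j = j} (trans (toℕ-fromℕ< m<h) 1+m≡j)
    ...   | refl = ≰⇒> λ heavy →
      none-here (lose (InB⇒∈Lo++L' y∈B) (subst (λ n → length S ≤ weight y * K ^ n) (toℕ-fromℕ< m<h) heavy))

  deepest-heavy : DeepestHeavy
  deepest-heavy = search (h ∸ 1) (∸-monoʳ-< (s≤s z≤n) 1≤h)
                         (λ j h-1<j → ⊥-elim (<⇒≱ h-1<j (∸-monoˡ-≤ 1 (toℕ<n j))))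

  module Centre (i : Fin h) (x : ℕ) (x∈B : InB i x) (heavy : Heavy i x)
                (none-below : NoHeavyBelow (toℕ i)) where

    Light : ℕ → Set
    Light u = weight u * K ≤ weight x

    K≤weight : K ≤ weight x
    K≤weight = *-cancelʳ-≤ K (weight x) (K ^ toℕ i) {{K^≢0 (toℕ i)}} (begin
      K ^ suc (toℕ i)     ≤⟨ ^-monoʳ-≤ K (toℕ<n i) ⟩
      K ^ h               ≤⟨ S-large ⟩
      length S            ≤⟨ heavy ⟩
      weight x * K ^ toℕ i ∎)
      where open ≤-Reasoning

    weight-bound : length S ≤ weight x * K ^ (h ∸ 1)
    weight-bound = ≤-trans heavy (*-monoʳ-≤ (weight x) (^-monoʳ-≤ K (∸-monoˡ-≤ 1 (toℕ<n i))))

    deep⇒light : ∀ u → (∀ j → InB j u → toℕ i < toℕ j) → Light u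
    deep⇒light u deep with any? (λ j → InB? j u) (allFin h)
    ... | yes has-kids with find has-kids
    ...   | j , _ , u∈B = <⇒≤ (*-cancelʳ-< (K ^ toℕ i) (weight u * K) (weight x) (begin-strict
      weight u * K * K ^ toℕ i   ≡⟨ *-assoc (weight u) K (K ^ toℕ i) ⟩
      weight u * K ^ suc (toℕ i) ≤⟨ *-monoʳ-≤ (weight u) (^-monoʳ-≤ K (deep j u∈B)) ⟩
      weight u * K ^ toℕ j       <⟨ none-below j (deep j u∈B) u u∈B ⟩
      length S                   ≤⟨ heavy ⟩
      weight x * K ^ toℕ i       ∎))
      where open ≤-Reasoning
    deep⇒light u deep | no childless = begin
      weight u * K  ≤⟨ *-monoˡ-≤ K weight≤1 ⟩
      1 * K         ≡⟨ *-identityˡ K ⟩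
      K             ≤⟨ K≤weight ⟩
      weight x      ∎
      where
      open ≤-Reasoning
      weight≤1 : weight u ≤ 1
      weight≤1 = Unique-⊆⇒length-≤ {ys = u ∷ []} (filter⁺ (_∈? desc h u) unique-S) λ s∈ →
        here (childless-desc (λ j u∈B → childless (lose (∈-allFin j) u∈B))
                             (proj₂ (∈-filter⁻ (_∈? desc h u) {xs = S} s∈)))

    forbidden-light : ∀ {s} (ch : Chain s (toℕ i) x) → All Light (forbidden ch)
    forbidden-light end = []
    forbidden-light (step j e eq _ _ _ _ c∈N _ rest) =
      deep⇒light _ (λ j' c∈B → ≤-reflexive (sym (trans (Lnext∩InB⇒successor c∈N c∈B) (cong suc eq)))) ∷
      All.tabulate later
      where
      later : ∀ {u} → u ∈ concat (edgesOf rest) → Light u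
      later {u} u∈ with ∈-concat⁻′ (edgesOf rest) u∈
      ... | e' , u∈e' , e'∈rest with edges-below rest e'∈rest
      ...   | j'' , e'∈ , i<j'' , _ =
        deep⇒light u λ j' u∈B → ≤-trans i<j'' (VH⇒≤InB-segment u∈B (e' , e'∈ , u∈e'))

    chain-below : ∀ {s} → s ∈ below x → Chain s (toℕ i) x
    chain-below s∈ = chain-to h ≤-refl (proj₂ (∈-filter⁻ (_∈? desc h x) {xs = S} s∈))
                              (λ j x∈Bj → cong toℕ (InB-segment-unique x∈Bj x∈B))

    below⊆S : ∀ {y s} → s ∈ below y → s ∈ S
    below⊆S {y} s∈ = proj₁ (∈-filter⁻ (_∈? desc h y) {xs = S} s∈)

    below-x-in-Hx : ∀ {s} → s ∈ below x → s ∈ S × VHx Q x s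
    below-x-in-Hx s∈ = below⊆S s∈ , chain-VHx x∈B (All.lookup S⊆Lh (below⊆S s∈)) (chain-below s∈)

    few-blocked : ∀ ℓ (F : List ℕ) → All Light F → length F ≤ ℓ * (h * r) → ℓ < p →
                  length (concatMap below F) < weight x
    few-blocked ℓ F F-light F-small ℓ<p = *-cancelʳ-< K _ _ (begin-strict
      length (concatMap below F) * K   ≤⟨ length-concatMap-*-≤ below F F-light ⟩
      length F * weight x              ≤⟨ *-monoˡ-≤ (weight x) F-small ⟩
      ℓ * (h * r) * weight x           <⟨ *-monoˡ-< (weight x) (*-monoˡ-< (h * r) ℓ<p) ⟩
      p * (h * r) * weight x           ≡⟨ cong (_* weight x) p*[h*r]≡K ⟩
      K * weight x                     ≡⟨ *-comm K (weight x) ⟩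
      weight x * K                     ∎)
      where
      open ≤-Reasoning
      instance
        weight≢0 : NonZero (weight x)
        weight≢0 = >-nonZero (≤-trans (>-nonZero⁻¹ K) K≤weight)
        h*r≢0 : NonZero (h * r)
        h*r≢0 = >-nonZero 1≤h*r
      p*[h*r]≡K : p * (h * r) ≡ K
      p*[h*r]≡K = trans (sym (*-assoc p h r)) (cong (_* r) (*-comm p h))

    record Leg : Set where
      field
        {target} : ℕ
        target∈S : target ∈ S
        chain    : Chain target (toℕ i) x

    open Leg

    fresh-leg : ∀ ℓ (F : List ℕ) → All Light F → length F ≤ ℓ * (h * r) → ℓ < p →
                Σ[ B ∈ Leg ] (∀ u → u ∈ F → target B ∉ desc h u)
    fresh-leg ℓ F F-light F-small ℓ<p
      with ∃∉-of-shorter (filter⁺ (_∈? desc h x) unique-S) (few-blocked ℓ F F-light F-small ℓ<p)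
    ... | s , s∈ , s∉blocked =
      record { target∈S = below⊆S s∈ ; chain = chain-below s∈ } ,
      λ u u∈F s∈desc-u →
        s∉blocked (∈-concatMap⁺ below {xs = F} (lose u∈F (∈-filter⁺ (_∈? desc h u) (below⊆S s∈) s∈desc-u)))

    length-forbidden-≤ : ∀ (B : Leg) → length (forbidden (chain B)) ≤ h * r
    length-forbidden-≤ B = ≤-trans (length-forbidden 1≤r (chain B))
                                   (*-monoˡ-≤ r (≤-trans (length-edgesOf (chain B)) (m∸n≤m h (toℕ i))))

    record PartialSpider (ℓ : ℕ) : Set where
      field
        legs           : Fin ℓ → Leg
        used           : List ℕ
        used-light     : All Light used
        used-small     : length used ≤ ℓ * (h * r)
        forbidden⊆used : ∀ a {u} → u ∈ forbidden (chain (legs a)) → u ∈ used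
        legs-disjoint  : ∀ a b → a ≢ b → MeetOnlyAt x (edgesOf (chain (legs a))) (edgesOf (chain (legs b)))

    open PartialSpider

    add-leg : ∀ {ℓ} → ℓ < p → PartialSpider ℓ → PartialSpider (suc ℓ)
    add-leg {ℓ} ℓ<p P with fresh-leg ℓ (used P) (used-light P) (used-small P) ℓ<p
    ... | B , B-fresh = record
      { legs           = legs′
      ; used           = forbidden (chain B) ++ used P
      ; used-light     = All-++⁺ (forbidden-light (chain B)) (used-light P)
      ; used-small     = ≤-trans (≤-reflexive (List.length-++ (forbidden (chain B))))
                                 (+-mono-≤ (length-forbidden-≤ B) (used-small P))
      ; forbidden⊆used = covered
      ; legs-disjoint  = disjoint
      }
      where
      legs′ : Fin (suc ℓ) → Leg
      legs′ fzero    = B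
      legs′ (fsuc a) = legs P a
      covered : ∀ a {u} → u ∈ forbidden (chain (legs′ a)) → u ∈ forbidden (chain B) ++ used P
      covered fzero    u∈ = ∈-++⁺ˡ u∈
      covered (fsuc a) u∈ = ∈-++⁺ʳ _ (forbidden⊆used P a u∈)
      B-avoids : ∀ a u → u ∈ forbidden (chain (legs P a)) → target B ∉ desc h u
      B-avoids a u u∈ = B-fresh u (forbidden⊆used P a u∈)
      disjoint : ∀ a b → a ≢ b → MeetOnlyAt x (edgesOf (chain (legs′ a))) (edgesOf (chain (legs′ b)))
      disjoint fzero    fzero    a≢b = ⊥-elim (a≢b refl)
      disjoint fzero    (fsuc b) _   u u∈B u∈b =
        legs-meet-at-root {i = i} (chain (legs P b)) (chain B) (B-avoids b) u u∈b u∈B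
      disjoint (fsuc a) fzero    _   u u∈a u∈B =
        legs-meet-at-root {i = i} (chain (legs P a)) (chain B) (B-avoids a) u u∈a u∈B
      disjoint (fsuc a) (fsuc b) a≢b = legs-disjoint P a b (λ a≡b → a≢b (cong fsuc a≡b))

    partial-spider : ∀ ℓ → ℓ ≤ p → PartialSpider ℓ
    partial-spider zero    _   = record
      { legs = λ () ; used = [] ; used-light = [] ; used-small = z≤n
      ; forbidden⊆used = λ () ; legs-disjoint = λ () }
    partial-spider (suc ℓ) ℓ<p = add-leg ℓ<p (partial-spider ℓ (<⇒≤ ℓ<p))

    leg-is-spider-leg : (B : Leg) → All (InHx Q x) (edgesOf (chain B)) × Monotone Q (edgesOf (chain B))
                                    × ∃[ s ] (s ∈ S × VHx Q x s × PathFromTo (edgesOf (chain B)) x s)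
    leg-is-spider-leg B = chain-in-Hx here (chain B) , chain-monotone (chain B) , target B , target∈S B ,
                          chain-VHx x∈B t∈Lh (chain B) , chain-PathFromTo x∈B t∈Lh (chain B)
      where
      t∈Lh : target B ∈ L (fromℕ h)
      t∈Lh = All.lookup S⊆Lh (target∈S B)

    spider : Spider Q x p S
    spider = (λ a → edgesOf (chain (legs P a))) , (λ a → leg-is-spider-leg (legs P a)) , legs-disjoint P
      where
      P : PartialSpider p
      P = partial-spider p ≤-refl

lemma5p3 : ∀ (h p r w : ℕ) → 1 ≤ h → 1 ≤ p → 3 ≤ r →
    (Q : LQT r h w) → IsLQT Q →
    (S : List ℕ) → Unique S → All (λ s → s ∈ LQT.L Q (fromℕ h)) S →
    (h * p * r) ^ h ≤ length S →
    ∃[ i ] ∃[ x ] ((x ∈ Lo Q i ⊎ x ∈ LQT.L' Q i)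
      × (∃[ T ] (Unique T × All (λ s → s ∈ S × VHx Q x s) T
                 × length S ≤ length T * (h * p * r) ^ (h ∸ 1)))
      × Spider Q x p S)
lemma5p3 h p r w 1≤h 1≤p 3≤r Q isQ S unique-S S⊆Lh S-large =
  let i , x , x∈B , heavy , none-below = deepest-heavy
      open Centre i x x∈B heavy none-below
  in i , x , x∈B ,
     (below x , filter⁺ (_∈? desc h x) unique-S , All.tabulate below-x-in-Hx , weight-bound) ,
     spider
  where
  open Spiders h p r w 1≤h 1≤p 3≤r Q isQ S unique-S S⊆Lh S-large
  open Descendants Q isQ
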